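{- Let $T$ be a text of length $n\ge 2$ whose last character is a sentinel occurring nowhere else in $T$ and lexicographically smallest. For each $i\in[n]$, the string $T[\mathit{SA}[i]\ldots\mathit{SA}[i]+\ell(i)-1]$ (the net occurrence candidate string at position $i$) is branching in $T$.
   Context: $T_k=T[k\ldots n]$; $\mathit{SA}$ is the suffix array; $\mathit{LCP}[i]$ ($2\le i\le n$) is the length of the longest common prefix of $T_{\mathit{SA}[i-1]}$ and $T_{\mathit{SA}[i]}$, with $\mathit{LCP}[1]=\mathit{LCP}[n+1]=0$; $\ell(i)=\max(\mathit{LCP}[i],\mathit{LCP}[i+1])$. A string $S$ (possibly empty) is branching in $T$ if it is the longest common prefix of two distinct suffixes of $T$. -}

module Defs where

open import Data.Nat using (ℕ; zero; suc; _<_; _⊔_)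
open import Data.Fin as Fin using (Fin; toℕ)
open import Data.List using (List; []; _∷_; length; drop; take; lookup)
open import Data.List.Relation.Binary.Lex.Core using (Lex-<)
open import Data.Product using (Σ; _×_; _,_)
open import Relation.Binary.PropositionalEquality using (_≡_; _≢_)
open import Relation.Nullary using (yes; no)
open import Data.Nat.Properties using (_≟_; <-trans; n<1+n)
open import Data.Nat using (_<?_)
open import Function.Definitions using (Bijective)

-- Texts are lists over the alphabet ℕ (ordered by the usual order on ℕ).
-- Positions are 0-based: position k : Fin (length T) is the paper's k+1.

suffix : (T : List ℕ) → Fin (length T) → List ℕ
suffix T k = drop (toℕ k) T

_<lex_ : List ℕ → List ℕ → Set
_<lex_ = Lex-< _≡_ _<_

lcpStr : List ℕ → List ℕ → List ℕ
lcpStr [] _ = []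
lcpStr (_ ∷ _) [] = []
lcpStr (x ∷ xs) (y ∷ ys) with x ≟ y
... | yes _ = x ∷ lcpStr xs ys
... | no _ = []

lcpLen : List ℕ → List ℕ → ℕ
lcpLen xs ys = length (lcpStr xs ys)

-- T has length n ≥ 2 and its last character is strictly smaller than every
-- other character of T (hence unique and lexicographically smallest).
HasSentinel : List ℕ → Set
HasSentinel T =
  Σ (2 Data.Nat.≤ length T) λ _ →
  Σ (Fin (length T)) λ last →
    (suc (toℕ last) ≡ length T) ×
    (∀ (k : Fin (length T)) → k ≢ last → lookup T last < lookup T k)

IsSuffixArray : (T : List ℕ) → (Fin (length T) → Fin (length T)) → Set
IsSuffixArray T SA =
  Bijective _≡_ _≡_ SA ×
  (∀ (i j : Fin (length T)) → i Fin.< j → suffix T (SA i) <lex suffix T (SA j))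

-- The paper's LCP array, with the paper's 1-based index r (1 ≤ r ≤ n+1):
-- LCP[r] = lcp of the suffixes of ranks r-1 and r for 2 ≤ r ≤ n, and 0
-- otherwise (in particular LCP[1] = LCP[n+1] = 0).  Rank r (1-based) is
-- SA (r-1) here, since SA is indexed 0-based.
LCP : (T : List ℕ) → (Fin (length T) → Fin (length T)) → ℕ → ℕ
LCP T SA (suc (suc k)) with suc k <? length T
... | yes p = lcpLen (suffix T (SA (Fin.fromℕ< (<-trans (n<1+n k) p))))
                     (suffix T (SA (Fin.fromℕ< p)))
... | no _ = 0
LCP T SA _ = 0

-- ℓ(i) = max(LCP[i], LCP[i+1]) for the paper's index i = toℕ r + 1.
ell : (T : List ℕ) → (Fin (length T) → Fin (length T)) → Fin (length T) → ℕ
ell T SA r = LCP T SA (suc (toℕ r)) ⊔ LCP T SA (suc (suc (toℕ r)))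

Branching : List ℕ → List ℕ → Set
Branching T S =
  Σ (Fin (length T)) λ j → Σ (Fin (length T)) λ k →
    (j ≢ k) × (S ≡ lcpStr (suffix T j) (suffix T k))

-- ℓ(i) is the maximum of the lcp lengths of T_SA[i] with the suffixes of the
-- neighbouring ranks i-1 and i+1, where a missing neighbour contributes 0;
-- n ≥ 2 guarantees that at least one neighbour exists, so the maximum is
-- attained by a real one.  SA being injective, that neighbour is a different
-- suffix, and the first ℓ(i) characters of T_SA[i] are exactly its longest
-- common prefix with T_SA[i].
{-# OPTIONS --safe #-}
module Submission where

open import Defs
open import Data.List using (List; []; _∷_; length; take)
open import Data.Nat using (ℕ; zero; suc; _≤_; _<_; _⊔_; _<?_)
open import Data.Nat.Properties using (_≟_; <-trans; n<1+n; ⊔-sel; ⊔-identityʳ; 1+n≢n)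
open import Data.Fin using (Fin; toℕ; fromℕ<)
open import Data.Fin.Properties using (toℕ<n; toℕ-fromℕ<; toℕ-injective)
open import Data.Product using (_,_; proj₁)
open import Data.Sum using (inj₁; inj₂)
open import Relation.Nullary using (¬_; Dec; yes; no; contradiction)
open import Relation.Unary using (Pred)
open import Relation.Binary.PropositionalEquality

⊔-preserves : ∀ {ℓ} {P : Pred ℕ ℓ} {x y : ℕ} → P x → P y → P (x ⊔ y)
⊔-preserves {P = P} {x} {y} px py with ⊔-sel x y
... | inj₁ x⊔y≡x = subst P (sym x⊔y≡x) px
... | inj₂ x⊔y≡y = subst P (sym x⊔y≡y) py

take-lcpLenˡ : (xs ys : List ℕ) → take (lcpLen xs ys) xs ≡ lcpStr xs ys
take-lcpLenˡ []       ys       = refl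
take-lcpLenˡ (x ∷ xs) []       = refl
take-lcpLenˡ (x ∷ xs) (y ∷ ys) with x ≟ y
... | yes _ = cong (x ∷_) (take-lcpLenˡ xs ys)
... | no  _ = refl

take-lcpLenʳ : (xs ys : List ℕ) → take (lcpLen xs ys) ys ≡ lcpStr xs ys
take-lcpLenʳ []       ys       = refl
take-lcpLenʳ (x ∷ xs) []       = refl
take-lcpLenʳ (x ∷ xs) (y ∷ ys) with x ≟ y
... | yes refl = cong (x ∷_) (take-lcpLenʳ xs ys)
... | no  _    = refl

module _ (T : List ℕ) where

  branching-take-lcpˡ : ∀ {j k} → j ≢ k →
    Branching T (take (lcpLen (suffix T j) (suffix T k)) (suffix T j))
  branching-take-lcpˡ {j} {k} j≢k =
    j , k , j≢k , take-lcpLenˡ (suffix T j) (suffix T k)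

  branching-take-lcpʳ : ∀ {j k} → j ≢ k →
    Branching T (take (lcpLen (suffix T j) (suffix T k)) (suffix T k))
  branching-take-lcpʳ {j} {k} j≢k =
    j , k , j≢k , take-lcpLenʳ (suffix T j) (suffix T k)

  module _ (SA : Fin (length T) → Fin (length T)) where

    LCP-inRange : ∀ {k} (k+1<n : suc k < length T) →
      LCP T SA (suc (suc k)) ≡
        lcpLen (suffix T (SA (fromℕ< (<-trans (n<1+n k) k+1<n))))
               (suffix T (SA (fromℕ< k+1<n)))
    LCP-inRange {k} k+1<n with suc k <? length T
    ... | yes _      = refl
    ... | no  k+1≮n = contradiction k+1<n k+1≮n

    LCP-outOfRange : ∀ {k} → ¬ (suc k < length T) → LCP T SA (suc (suc k)) ≡ 0
    LCP-outOfRange {k} k+1≮n with suc k <? length T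
    ... | yes k+1<n = contradiction k+1<n k+1≮n
    ... | no  _     = refl

    module _ (isSA : IsSuffixArray T SA) where

      SA-adjacent-≢ : ∀ {a b} → toℕ b ≡ suc (toℕ a) → SA a ≢ SA b
      SA-adjacent-≢ {a} {b} b≡a+1 SAa≡SAb =
        1+n≢n (trans (sym b≡a+1) (cong toℕ (sym (proj₁ (proj₁ isSA) SAa≡SAb))))

      -- LCP[k+2] is the lcp of the suffixes of (0-based) ranks k and k+1:
      -- rank k is its lower end, rank k+1 its upper end.
      branching-LCP-lower : ∀ {k i} (k+1<n : suc k < length T) → toℕ i ≡ k →
        Branching T (take (LCP T SA (suc (suc k))) (suffix T (SA i)))
      branching-LCP-lower {k} {i} k+1<n i≡k
        rewrite LCP-inRange k+1<n
              | toℕ-injective (trans i≡k (sym (toℕ-fromℕ< (<-trans (n<1+n k) k+1<n))))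
        = branching-take-lcpˡ (SA-adjacent-≢ (trans (toℕ-fromℕ< k+1<n)
                                                   (cong suc (sym (toℕ-fromℕ< _)))))

      branching-LCP-upper : ∀ {k i} (k+1<n : suc k < length T) → toℕ i ≡ suc k →
        Branching T (take (LCP T SA (suc (suc k))) (suffix T (SA i)))
      branching-LCP-upper {k} {i} k+1<n i≡k+1
        rewrite LCP-inRange k+1<n
              | toℕ-injective (trans i≡k+1 (sym (toℕ-fromℕ< k+1<n)))
        = branching-take-lcpʳ (SA-adjacent-≢ (trans (toℕ-fromℕ< k+1<n)
                                                   (cong suc (sym (toℕ-fromℕ< _)))))

      branching-take-ell : 2 ≤ length T → (i : Fin (length T)) →
        Branching T (take (ell T SA i) (suffix T (SA i)))
      branching-take-ell 2≤n i = go (toℕ i) refl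
        where
        go : ∀ r → toℕ i ≡ r →
          Branching T (take (LCP T SA (suc r) ⊔ LCP T SA (suc (suc r))) (suffix T (SA i)))
        go zero    i≡0   = branching-LCP-lower 2≤n i≡0
        go (suc k) i≡k+1 = withNext (suc (suc k) <? length T)
          where
          P : ℕ → Set
          P m = Branching T (take m (suffix T (SA i)))

          withPrevious : P (LCP T SA (suc (suc k)))
          withPrevious = branching-LCP-upper (subst (_< length T) i≡k+1 (toℕ<n i)) i≡k+1

          withNext : Dec (suc (suc k) < length T) →
            P (LCP T SA (suc (suc k)) ⊔ LCP T SA (suc (suc (suc k))))
          withNext (yes k+2<n) = ⊔-preserves {P = P} withPrevious (branching-LCP-lower k+2<n i≡k+1)
          withNext (no  k+2≮n) rewrite LCP-outOfRange k+2≮n | ⊔-identityʳ (LCP T SA (suc (suc k))) =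
            withPrevious

mainTheorem12 : (T : List ℕ) → HasSentinel T →
    (SA : Fin (length T) → Fin (length T)) → IsSuffixArray T SA →
    (i : Fin (length T)) → Branching T (take (ell T SA i) (suffix T (SA i)))
mainTheorem12 T (2≤n , _) SA isSA = branching-take-ell T SA isSA 2≤n
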